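{- Let $(S,\to)$ be a transition system and $\phi$ a predicate on $S$, and suppose there is no state $s$ with $\phi(s)$ lying on a cycle of positive length (i.e. no path $s\to s_1\to\cdots\to s_n = s$ with $n\ge1$ and $\phi(s)$). Then: (1) If for every $s\in S$ the set $\{x \mid s\to^* x \wedge \phi(x)\}$ is finite, then $f(s) := |\{x \mid s \to^* x \wedge \phi(x)\}|$ is a topological numbering of $\to$ with respect to $\phi$. (2) If $h$ is a topological numbering in the classical sense of the strongly connected components of $\to$ (an integer-valued function on SCCs with $h(C)\ge h(C')$ whenever some state of $C$ has a $\to$-edge to some state of $C'$, and $h(C) > h(C')$ if moreover $C\neq C'$), then $g(s) := h(C)$ for $s\in C$ is a topological numbering of $\to$ with respect to $\phi$.
   Context: $\to^*$ denotes the reflexive-transitive closure of $\to$. A topological numbering of a transition system $(S,\to)$ with respect to a predicate $\phi$ is a function $f : S \to \mathbb{Z}$ such that (1) for all $s,t$, if $s\to t$ then $f(s)\ge f(t)$; and (2) for all $s,t$, if $s\to t$ and $\phi(s)$ then $f(s) > f(t)$. Strongly connected components (SCCs) are the equivalence classes of mutual $\to^*$-reachability. -}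

module Defs where

open import Data.Nat using (ℕ)
open import Data.Fin using (Fin)
open import Data.Integer using (ℤ; _≤_; _<_)
open import Data.Product using (Σ; ∃; _×_)
open import Relation.Nullary using (¬_)
open import Relation.Binary.PropositionalEquality using (_≡_; _≢_)
open import Relation.Binary.Construct.Closure.ReflexiveTransitive using (Star)

_⟶*_ : {S : Set} → (S → S → Set) → S → S → Set
_⟶*_ _⟶_ = Star _⟶_

NoPhiCycle : {S : Set} → (S → S → Set) → (S → Set) → Set
NoPhiCycle {S} _⟶_ φ = (s : S) → φ s → ¬ (∃ λ s₁ → (s ⟶ s₁) × Star _⟶_ s₁ s)

IsTopNumbering : {S : Set} → (S → S → Set) → (S → Set) → (S → ℤ) → Set
IsTopNumbering {S} _⟶_ φ f =
  ({s t : S} → s ⟶ t → f t ≤ f s) ×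
  ({s t : S} → s ⟶ t → φ s → f t < f s)

record Finite {S : Set} (P : S → Set) : Set where
  field
    size     : ℕ
    enum     : Fin size → S
    enum-in  : (i : Fin size) → P (enum i)
    enum-inj : (i j : Fin size) → enum i ≡ enum j → i ≡ j
    complete : (x : S) → P x → Σ (Fin size) λ i → enum i ≡ x
open Finite public

ReachPhi : {S : Set} → (S → S → Set) → (S → Set) → S → S → Set
ReachPhi _⟶_ φ s x = Star _⟶_ s x × φ x

MutReach : {S : Set} → (S → S → Set) → S → S → Set
MutReach _⟶_ s t = Star _⟶_ s t × Star _⟶_ t s

-- C together with comp : S → C is the set of SCCs of ⟶ (the quotient of S
-- by mutual reachability): comp is surjective and identifies exactly the
-- mutually reachable states.
record IsSCCQuotient {S : Set} (_⟶_ : S → S → Set) (C : Set) (comp : S → C) : Set where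
  field
    surj  : (c : C) → Σ S λ s → comp s ≡ c
    exact : (s t : S) → (comp s ≡ comp t → MutReach _⟶_ s t) × (MutReach _⟶_ s t → comp s ≡ comp t)

IsSCCTopNumbering : {S : Set} → (S → S → Set) → {C : Set} → (S → C) → (C → ℤ) → Set
IsSCCTopNumbering {S} _⟶_ comp h =
  ({s t : S} → s ⟶ t → h (comp t) ≤ h (comp s)) ×
  ({s t : S} → s ⟶ t → comp s ≢ comp t → h (comp t) < h (comp s))

-- If φ s and s ⟶ t, everything φ-reachable from t is φ-reachable from s, while s itself
-- is φ-reachable from s but not from t (that would close a cycle through s). So the
-- count of φ-reachable states drops strictly along such an edge and never grows along
-- any edge. For the SCC numbering, an edge out of a φ-state cannot stay inside its
-- component for the same reason, so the classical strict inequality applies.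
module Submission where

open import Defs
open import Function using (_∘_; Injective)
open import Data.Integer using (ℤ; +_; +≤+; +<+)
open import Data.Product using (_×_; _,_; proj₁; proj₂)
open import Data.Nat using (suc; s≤s; _≤_; _<_)
open import Data.Fin using (Fin; punchOut)
open import Data.Fin.Properties using (injective⇒≤; punchOut-injective)
open import Relation.Nullary using (¬_)
open import Relation.Unary using (_⊆_)
open import Relation.Binary.PropositionalEquality using (_≡_; _≢_; sym; trans; cong; subst)
open import Relation.Binary.Construct.Closure.ReflexiveTransitive using (ε; _◅_)

injective-missing⇒< : ∀ {m n} {f : Fin m → Fin n} → Injective _≡_ _≡_ f →
                      (k : Fin n) → (∀ i → k ≢ f i) → m < n
injective-missing⇒< {n = suc _} {f} f-injective k k∉f =
  s≤s (injective⇒≤ punchOut∘f-injective)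
  where
  punchOut∘f-injective : Injective _≡_ _≡_ (λ i → punchOut (k∉f i))
  punchOut∘f-injective {i} {j} = f-injective ∘ punchOut-injective (k∉f i) (k∉f j)

module _ {S : Set} {P Q : S → Set} (finP : Finite P) (finQ : Finite Q) (P⊆Q : P ⊆ Q) where

  private
    index : Fin (size finP) → Fin (size finQ)
    index i = proj₁ (complete finQ (enum finP i) (P⊆Q (enum-in finP i)))

    enum-index : ∀ i → enum finQ (index i) ≡ enum finP i
    enum-index i = proj₂ (complete finQ (enum finP i) (P⊆Q (enum-in finP i)))

    index-injective : Injective _≡_ _≡_ index
    index-injective {i} {j} eq = enum-inj finP i j
      (trans (sym (enum-index i)) (trans (cong (enum finQ) eq) (enum-index j)))

  ⊆⇒size≤ : size finP ≤ size finQ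
  ⊆⇒size≤ = injective⇒≤ index-injective

  ⊊⇒size< : ∀ {x} → Q x → ¬ P x → size finP < size finQ
  ⊊⇒size< {x} Qx ¬Px = injective-missing⇒< index-injective k k∉index
    where
    k : Fin (size finQ)
    k = proj₁ (complete finQ x Qx)

    k∉index : ∀ i → k ≢ index i
    k∉index i k≡index-i = ¬Px (subst P x≡enum-i (enum-in finP i))
      where
      x≡enum-i : enum finP i ≡ x
      x≡enum-i = trans (sym (enum-index i))
                       (trans (cong (enum finQ) (sym k≡index-i)) (proj₂ (complete finQ x Qx)))

module _ {S : Set} {_⟶_ : S → S → Set} {φ : S → Set} where

  ReachPhi-⟶ : ∀ {s t} → s ⟶ t → ReachPhi _⟶_ φ t ⊆ ReachPhi _⟶_ φ s
  ReachPhi-⟶ s⟶t (t⟶*x , φx) = s⟶t ◅ t⟶*x , φx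

  ReachPhi-refl : ∀ {s} → φ s → ReachPhi _⟶_ φ s s
  ReachPhi-refl φs = ε , φs

  NoPhiCycle⇒¬ReachPhi-back : NoPhiCycle _⟶_ φ → ∀ {s t} → s ⟶ t → φ s →
                              ¬ ReachPhi _⟶_ φ t s
  NoPhiCycle⇒¬ReachPhi-back noCycle {s} {t} s⟶t φs (t⟶*s , _) = noCycle s φs (t , s⟶t , t⟶*s)

  NoPhiCycle⇒comp-≢ : NoPhiCycle _⟶_ φ → ∀ {C} {comp : S → C} → IsSCCQuotient _⟶_ C comp →
                      ∀ {s t} → s ⟶ t → φ s → comp s ≢ comp t
  NoPhiCycle⇒comp-≢ noCycle quotient {s} {t} s⟶t φs same =
    noCycle s φs (t , s⟶t , proj₂ (proj₁ (IsSCCQuotient.exact quotient s t) same))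

  ReachPhi-size-isTopNumbering : NoPhiCycle _⟶_ φ →
    (fin : (s : S) → Finite (ReachPhi _⟶_ φ s)) →
    IsTopNumbering _⟶_ φ (λ s → + size (fin s))
  ReachPhi-size-isTopNumbering noCycle fin =
      (λ {s} {t} s⟶t → +≤+ (⊆⇒size≤ (fin t) (fin s) (ReachPhi-⟶ s⟶t)))
    , (λ {s} {t} s⟶t φs → +<+ (⊊⇒size< (fin t) (fin s) (ReachPhi-⟶ s⟶t)
                                 (ReachPhi-refl φs) (NoPhiCycle⇒¬ReachPhi-back noCycle s⟶t φs)))

  SCCTopNumbering⇒isTopNumbering : NoPhiCycle _⟶_ φ →
    ∀ {C} {comp : S → C} → IsSCCQuotient _⟶_ C comp →
    (h : C → ℤ) → IsSCCTopNumbering _⟶_ comp h →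
    IsTopNumbering _⟶_ φ (λ s → h (comp s))
  SCCTopNumbering⇒isTopNumbering noCycle quotient h (h-mono , h-strict) =
    h-mono , λ s⟶t φs → h-strict s⟶t (NoPhiCycle⇒comp-≢ noCycle quotient s⟶t φs)

proposition3 : {S : Set} (_⟶_ : S → S → Set) (φ : S → Set) →
    NoPhiCycle _⟶_ φ →
    ((fin : (s : S) → Finite (ReachPhi _⟶_ φ s)) →
      IsTopNumbering _⟶_ φ (λ s → + size (fin s)))
    ×
    ((C : Set) (comp : S → C) → IsSCCQuotient _⟶_ C comp →
      (h : C → ℤ) → IsSCCTopNumbering _⟶_ comp h →
      IsTopNumbering _⟶_ φ (λ s → h (comp s)))
proposition3 _⟶_ φ noCycle =
    ReachPhi-size-isTopNumbering noCycle
  , λ C comp quotient → SCCTopNumbering⇒isTopNumbering noCycle quotient
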